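{- Let $k$ be a field and let $\sim$ be the equivalence relation on $F_k$ whose two classes are $\mathcal A$ and $\mathcal C$. Extend $x\mapsto x+1$ and $x\mapsto x-1$ to $k\cup\{\epsilon\}$ by $\epsilon\pm1=\epsilon$. (i) For all $x,y\in F_k$ one has $x00y\sim xy$. Moreover, for all $x,y\in F_k$ and $\alpha,\beta\in k\cup\{\epsilon\}$ such that $\alpha=\epsilon$ implies $x=\epsilon$ and $\beta=\epsilon$ implies $y=\epsilon$, one has $$x\alpha1\beta y\sim x(\alpha-1)(\beta-1)y,\qquad x\alpha(-1)\beta y\sim x(\alpha+1)(\beta+1)y.$$ (ii) For all $\beta\in k$ and $x\in F_k$: if $0\ne\alpha\in k$ then $\alpha\beta x\sim(\beta-\alpha^{ -1})x$; and $0\beta x\sim x$.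
   Context: For a field $k$, let $F_k$ be the free monoid of all finite words with letters in $k$, with empty word $\epsilon$ and concatenation as product; a letter $\alpha\in k$ is a word of length one, and $\epsilon$ inserted in a word contributes nothing. For $\alpha\in k$ put $M_\alpha=\begin{pmatrix}0&-1\\1&\alpha\end{pmatrix}$ and $\pi(\alpha_1\cdots\alpha_l)=M_{\alpha_1}\cdots M_{\alpha_l}\in\mathrm{SL}_2(k)$ (identity for $\epsilon$). Let $\mathcal A$ be the set of words $w$ with $\pi(w)$ having lower-right entry $0$ (equivalently $\pi(w)=\begin{pmatrix}a&-b\\ b^{ -1}&0\end{pmatrix}$, $a\in k$, $b\in k^*$), and $\mathcal C=F_k\setminus\mathcal A$. -}

module Defs where

open import Level using (Level; suc; _⊔_)
open import Algebra.Bundles using (CommutativeRing)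
open import Data.List using (List; []; _∷_; _++_)
open import Data.Maybe using (Maybe; just; nothing)
open import Data.Product using (_×_)
open import Relation.Nullary using (¬_)

-- A field: a commutative ring with 0 ≉ 1 in which every nonzero element
-- has a multiplicative inverse (given by a total function _⁻¹, whose value
-- at 0 is irrelevant).
record Field (c ℓ : Level) : Set (suc (c ⊔ ℓ)) where
  field
    commutativeRing : CommutativeRing c ℓ
  open CommutativeRing commutativeRing public
  field
    _⁻¹       : Carrier → Carrier
    0≉1       : ¬ (0# ≈ 1#)
    ⁻¹-inverseʳ : ∀ x → ¬ (x ≈ 0#) → x * (x ⁻¹) ≈ 1#

module FieldWords {c ℓ : Level} (k : Field c ℓ) where
  open Field k

  record Mat : Set c where
    constructor mat
    field
      e11 e12 e21 e22 : Carrier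
  open Mat public

  _·_ : Mat → Mat → Mat
  mat a b c' d · mat a' b' c'' d' =
    mat (a * a' + b * c'') (a * b' + b * d')
        (c' * a' + d * c'') (c' * b' + d * d')

  I₂ : Mat
  I₂ = mat 1# 0# 0# 1#

  M : Carrier → Mat
  M α = mat 0# (- 1#) 1# α

  Word : Set c
  Word = List Carrier

  π : Word → Mat
  π []      = I₂
  π (α ∷ w) = M α · π w

  InA : Word → Set ℓ
  InA w = e22 (π w) ≈ 0#

  _∼_ : Word → Word → Set ℓ
  x ∼ y = (InA x → InA y) × (InA y → InA x)

  -- k ∪ {ε}, with ε represented by nothing
  toWord : Maybe Carrier → Word
  toWord nothing  = []
  toWord (just α) = α ∷ []

  inc : Maybe Carrier → Maybe Carrier
  inc nothing  = nothing
  inc (just α) = just (α + 1#)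

  dec : Maybe Carrier → Maybe Carrier
  dec nothing  = nothing
  dec (just α) = just (α - 1#)

-- A word w lies in 𝒜 iff the (2,2) entry of π w vanishes, and that entry of
-- π (x ++ w ++ y) = π x · π w · π y is linear in π w.  So if π w = s · π w′
-- with s ≠ 0, then x w y and x w′ y lie in the same class.  The relations come
-- from the identities π (0 0) = −I, M_α M_1 M_β = M_{α−1} M_{β−1} and
-- M_α M_{−1} M_β = −M_{α+1} M_{β+1}.  When α (resp. β) is ε the context is empty
-- on that side, and only the second row (resp. column) of the product has to
-- match; in (ii), the second row of M_α M_β is α times that of M_{β−α⁻¹}.
module Submission where

open import Algebra.Bundles using (CommutativeRing)
open import Data.Integer.Base as ℤ using (ℤ; +_; -[1+_]; _⊖_; _◃_; +-*-rawRing)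
import Data.Integer.Properties as ℤ
open import Data.List.Base using (List; []; _∷_; _++_)
open import Data.Maybe.Base as Maybe using (Maybe; just; nothing)
open import Data.Nat.Base as ℕ using (ℕ; suc)
import Data.Nat.Properties as ℕ
open import Data.Product.Base using (_×_; _,_)
open import Data.Sign.Base as Sign using ()
open import Defs
open import Level using (Level; _⊔_)
open import Relation.Binary.Consequences using (dec⇒weaklyDec)
import Relation.Binary.PropositionalEquality as ≡
open import Relation.Binary.PropositionalEquality using (_≡_)
open import Relation.Nullary using (¬_; yes; no)
import Algebra.Solver.Ring
import Algebra.Solver.Ring.AlmostCommutativeRing as ACR

module IntegerCoefficientSolver {c ℓ} (R : CommutativeRing c ℓ) where
  open CommutativeRing R
  open import Algebra.Properties.Ring ring using (-0#≈0#; -‿involutive; -‿distribˡ-*; -‿distribʳ-*)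
  open import Algebra.Properties.AbelianGroup +-abelianGroup using (⁻¹-anti-homo‿-; ⁻¹-∙-comm)
  open import Algebra.Properties.Group +-group using (//-rightDividesʳ)
  open import Relation.Binary.Reasoning.Setoid setoid

  open import Algebra.Properties.Semiring.Mult.TCOptimised semiring using (×-homo-+; ×1-homo-*)

  -- Unlike _×_, the optimised multiple has 0 ×′ 1# = 0# and 1 ×′ 1# = 1# definitionally,
  -- so the solver constants 0 and 1 evaluate to 0# and 1# on the nose.
  open import Algebra.Definitions.RawMonoid +-rawMonoid using (_×′_)

  ⟦_⟧ℤ : ℤ → Carrier
  ⟦ + n ⟧ℤ      = n ×′ 1#
  ⟦ -[1+ n ] ⟧ℤ = - (suc n ×′ 1#)

  ⟦-⟧ℤ : ∀ i → ⟦ ℤ.- i ⟧ℤ ≈ - ⟦ i ⟧ℤ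
  ⟦-⟧ℤ (+ 0)     = sym -0#≈0#
  ⟦-⟧ℤ (+ suc n) = refl
  ⟦-⟧ℤ -[1+ n ]  = sym (-‿involutive _)

  ⟦⊖⟧ℤ-≥ : ∀ {m n} → n ℕ.≤ m → ⟦ m ⊖ n ⟧ℤ ≈ m ×′ 1# - n ×′ 1#
  ⟦⊖⟧ℤ-≥ {m} {n} n≤m = begin
    ⟦ m ⊖ n ⟧ℤ                          ≡⟨ ≡.cong ⟦_⟧ℤ (ℤ.⊖-≥ n≤m) ⟩
    (m ℕ.∸ n) ×′ 1#                       ≈⟨ //-rightDividesʳ (n ×′ 1#) _ ⟨
    ((m ℕ.∸ n) ×′ 1# + n ×′ 1#) - n ×′ 1#   ≈⟨ +-congʳ (×-homo-+ 1# (m ℕ.∸ n) n) ⟨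
    ((m ℕ.∸ n) ℕ.+ n) ×′ 1# - n ×′ 1#      ≡⟨ ≡.cong (λ j → j ×′ 1# - n ×′ 1#) (ℕ.m∸n+n≡m n≤m) ⟩
    m ×′ 1# - n ×′ 1#                      ∎

  ⟦⊖⟧ℤ : ∀ m n → ⟦ m ⊖ n ⟧ℤ ≈ m ×′ 1# - n ×′ 1#
  ⟦⊖⟧ℤ m n with n ℕ.≤? m
  ... | yes n≤m = ⟦⊖⟧ℤ-≥ n≤m
  ... | no n≰m  = begin
    ⟦ m ⊖ n ⟧ℤ            ≡⟨ ≡.cong ⟦_⟧ℤ (ℤ.⊖-swap m n) ⟩
    ⟦ ℤ.- (n ⊖ m) ⟧ℤ      ≈⟨ ⟦-⟧ℤ (n ⊖ m) ⟩
    - ⟦ n ⊖ m ⟧ℤ          ≈⟨ -‿cong (⟦⊖⟧ℤ-≥ (ℕ.≰⇒≥ n≰m)) ⟩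
    - (n ×′ 1# - m ×′ 1#)   ≈⟨ ⁻¹-anti-homo‿- _ _ ⟩
    m ×′ 1# - n ×′ 1#       ∎

  ⟦+⟧ℤ : ∀ i j → ⟦ i ℤ.+ j ⟧ℤ ≈ ⟦ i ⟧ℤ + ⟦ j ⟧ℤ
  ⟦+⟧ℤ (+ m)    (+ n)    = ×-homo-+ 1# m n
  ⟦+⟧ℤ (+ m)    -[1+ n ] = ⟦⊖⟧ℤ m (suc n)
  ⟦+⟧ℤ -[1+ m ] (+ n)    = trans (⟦⊖⟧ℤ n (suc m)) (+-comm _ _)
  ⟦+⟧ℤ -[1+ m ] -[1+ n ] = begin
    - (suc (suc (m ℕ.+ n)) ×′ 1#)      ≡⟨ ≡.cong (λ j → - (suc j ×′ 1#)) (ℕ.+-suc m n) ⟨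
    - ((suc m ℕ.+ suc n) ×′ 1#)         ≈⟨ -‿cong (×-homo-+ 1# (suc m) (suc n)) ⟩
    - (suc m ×′ 1# + suc n ×′ 1#)        ≈⟨ ⁻¹-∙-comm _ _ ⟨
    - (suc m ×′ 1#) + - (suc n ×′ 1#)    ∎

  ⟦+◃⟧ℤ : ∀ n → ⟦ Sign.+ ◃ n ⟧ℤ ≈ n ×′ 1#
  ⟦+◃⟧ℤ 0       = refl
  ⟦+◃⟧ℤ (suc n) = refl

  ⟦-◃⟧ℤ : ∀ n → ⟦ Sign.- ◃ n ⟧ℤ ≈ - (n ×′ 1#)
  ⟦-◃⟧ℤ 0       = sym -0#≈0#
  ⟦-◃⟧ℤ (suc n) = refl

  ⟦*⟧ℤ : ∀ i j → ⟦ i ℤ.* j ⟧ℤ ≈ ⟦ i ⟧ℤ * ⟦ j ⟧ℤ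
  ⟦*⟧ℤ (+ m)    (+ n)    = trans (⟦+◃⟧ℤ (m ℕ.* n)) (×1-homo-* m n)
  ⟦*⟧ℤ (+ m)    -[1+ n ] =
    trans (⟦-◃⟧ℤ (m ℕ.* suc n)) (trans (-‿cong (×1-homo-* m (suc n))) (-‿distribʳ-* _ _))
  ⟦*⟧ℤ -[1+ m ] (+ n)    =
    trans (⟦-◃⟧ℤ (suc m ℕ.* n)) (trans (-‿cong (×1-homo-* (suc m) n)) (-‿distribˡ-* _ _))
  ⟦*⟧ℤ -[1+ m ] -[1+ n ] = begin
    (suc m ℕ.* suc n) ×′ 1#            ≈⟨ ×1-homo-* (suc m) (suc n) ⟩
    suc m ×′ 1# * suc n ×′ 1#           ≈⟨ -‿involutive _ ⟨
    - - (suc m ×′ 1# * suc n ×′ 1#)     ≈⟨ -‿cong (-‿distribʳ-* _ _) ⟩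
    - (suc m ×′ 1# * - (suc n ×′ 1#))   ≈⟨ -‿distribˡ-* _ _ ⟩
    - (suc m ×′ 1#) * - (suc n ×′ 1#)   ∎

  ⟦⟧ℤ-morphism : +-*-rawRing ACR.-Raw-AlmostCommutative⟶ ACR.fromCommutativeRing R
  ⟦⟧ℤ-morphism = record
    { ⟦_⟧    = ⟦_⟧ℤ
    ; +-homo = ⟦+⟧ℤ
    ; *-homo = ⟦*⟧ℤ
    ; -‿homo = ⟦-⟧ℤ
    ; 0-homo = refl
    ; 1-homo = refl
    }

  ⟦⟧ℤ-≟ : ∀ i j → Maybe (⟦ i ⟧ℤ ≈ ⟦ j ⟧ℤ)
  ⟦⟧ℤ-≟ i j = Maybe.map (λ i≡j → reflexive (≡.cong ⟦_⟧ℤ i≡j)) (dec⇒weaklyDec ℤ._≟_ i j)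

  open Algebra.Solver.Ring +-*-rawRing (ACR.fromCommutativeRing R) ⟦⟧ℤ-morphism ⟦⟧ℤ-≟ public

module WordClasses {c ℓ} (k : Field c ℓ) where
  open Field k
  open FieldWords k
  open import Algebra.Properties.Ring ring using (-0#≈0#; -‿involutive)
  open IntegerCoefficientSolver commutativeRing using (solve; _:=_; Polynomial; con; _:+_; _:*_; :-_; _:-_)
  open import Relation.Binary.Reasoning.Setoid setoid

  infix 4 _≋_
  record _≋_ (A B : Mat) : Set ℓ where
    field
      e11≈ : e11 A ≈ e11 B
      e12≈ : e12 A ≈ e12 B
      e21≈ : e21 A ≈ e21 B
      e22≈ : e22 A ≈ e22 B
  open _≋_

  ≋-sym : ∀ {A B} → A ≋ B → B ≋ A
  ≋-sym p = record
    { e11≈ = sym (e11≈ p) ; e12≈ = sym (e12≈ p)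
    ; e21≈ = sym (e21≈ p) ; e22≈ = sym (e22≈ p) }

  ≋-trans : ∀ {A B C} → A ≋ B → B ≋ C → A ≋ C
  ≋-trans p q = record
    { e11≈ = trans (e11≈ p) (e11≈ q) ; e12≈ = trans (e12≈ p) (e12≈ q)
    ; e21≈ = trans (e21≈ p) (e21≈ q) ; e22≈ = trans (e22≈ p) (e22≈ q) }

  ·-congˡ : ∀ A {B B′} → B ≋ B′ → A · B ≋ A · B′
  ·-congˡ A p = record
    { e11≈ = combination-cong (e11≈ p) (e21≈ p) ; e12≈ = combination-cong (e12≈ p) (e22≈ p)
    ; e21≈ = combination-cong (e11≈ p) (e21≈ p) ; e22≈ = combination-cong (e12≈ p) (e22≈ p) }
    where
    combination-cong : ∀ {a b u u′ v v′} → u ≈ u′ → v ≈ v′ → a * u + b * v ≈ a * u′ + b * v′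
    combination-cong u≈u′ v≈v′ = +-cong (*-congˡ u≈u′) (*-congˡ v≈v′)

  ·-identityˡ : ∀ A → I₂ · A ≋ A
  ·-identityˡ A = record
    { e11≈ = first (e11 A) (e21 A) ; e12≈ = first (e12 A) (e22 A)
    ; e21≈ = second (e11 A) (e21 A) ; e22≈ = second (e12 A) (e22 A) }
    where
    first : ∀ u v → 1# * u + 0# * v ≈ u
    first u v = trans (+-cong (*-identityˡ u) (zeroˡ v)) (+-identityʳ u)
    second : ∀ u v → 0# * u + 1# * v ≈ v
    second u v = trans (+-cong (zeroˡ u) (*-identityˡ v)) (+-identityˡ v)

  -- Every entry of (A · B) · C has this shape, for a row of A and a column of C.
  entry-assoc : ∀ a₁ a₂ b₁₁ b₁₂ b₂₁ b₂₂ c₁ c₂ →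
    (a₁ * b₁₁ + a₂ * b₂₁) * c₁ + (a₁ * b₁₂ + a₂ * b₂₂) * c₂
      ≈ a₁ * (b₁₁ * c₁ + b₁₂ * c₂) + a₂ * (b₂₁ * c₁ + b₂₂ * c₂)
  entry-assoc = solve 8 (λ a₁ a₂ b₁₁ b₁₂ b₂₁ b₂₂ c₁ c₂ →
    (a₁ :* b₁₁ :+ a₂ :* b₂₁) :* c₁ :+ (a₁ :* b₁₂ :+ a₂ :* b₂₂) :* c₂
      := a₁ :* (b₁₁ :* c₁ :+ b₁₂ :* c₂) :+ a₂ :* (b₂₁ :* c₁ :+ b₂₂ :* c₂)) refl

  ·-assoc : ∀ A B C → (A · B) · C ≋ A · (B · C)
  ·-assoc (mat a₁₁ a₁₂ a₂₁ a₂₂) (mat b₁₁ b₁₂ b₂₁ b₂₂) (mat c₁₁ c₁₂ c₂₁ c₂₂) = record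
    { e11≈ = entry-assoc a₁₁ a₁₂ b₁₁ b₁₂ b₂₁ b₂₂ c₁₁ c₂₁
    ; e12≈ = entry-assoc a₁₁ a₁₂ b₁₁ b₁₂ b₂₁ b₂₂ c₁₂ c₂₂
    ; e21≈ = entry-assoc a₂₁ a₂₂ b₁₁ b₁₂ b₂₁ b₂₂ c₁₁ c₂₁
    ; e22≈ = entry-assoc a₂₁ a₂₂ b₁₁ b₁₂ b₂₁ b₂₂ c₁₂ c₂₂ }

  π-++ : ∀ x y → π (x ++ y) ≋ π x · π y
  π-++ []      y = ≋-sym (·-identityˡ (π y))
  π-++ (α ∷ x) y = ≋-trans (·-congˡ (M α) (π-++ x y)) (≋-sym (·-assoc (M α) (π x) (π y)))

  π-++-++ : ∀ x w y → π (x ++ w ++ y) ≋ π x · (π w · π y)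
  π-++-++ x w y = ≋-trans (π-++ x (w ++ y)) (·-congˡ (π x) (π-++ w y))

  x*y≈0⇒y≈0 : ∀ {x y} → ¬ x ≈ 0# → x * y ≈ 0# → y ≈ 0#
  x*y≈0⇒y≈0 {x} {y} x≉0 xy≈0 = begin
    y                 ≈⟨ *-identityˡ y ⟨
    1# * y            ≈⟨ *-congʳ (trans (*-comm (x ⁻¹) x) (⁻¹-inverseʳ x x≉0)) ⟨
    (x ⁻¹ * x) * y    ≈⟨ *-assoc (x ⁻¹) x y ⟩
    x ⁻¹ * (x * y)    ≈⟨ *-congˡ xy≈0 ⟩
    x ⁻¹ * 0#         ≈⟨ zeroʳ (x ⁻¹) ⟩
    0#                ∎

  1≉0 : ¬ 1# ≈ 0#
  1≉0 1≈0 = 0≉1 (sym 1≈0)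

  -1≉0 : ¬ - 1# ≈ 0#
  -1≉0 -1≈0 = 1≉0 (trans (sym (-‿involutive 1#)) (trans (-‿cong -1≈0) -0#≈0#))

  ∼-of-e22 : ∀ {s} u v → ¬ s ≈ 0# → e22 (π u) ≈ s * e22 (π v) → u ∼ v
  ∼-of-e22 {s} u v s≉0 u≈sv =
      (λ u∈𝒜 → x*y≈0⇒y≈0 s≉0 (trans (sym u≈sv) u∈𝒜))
    , (λ v∈𝒜 → trans u≈sv (trans (*-congˡ v∈𝒜) (zeroʳ s)))

  record TwoSided (s : Carrier) (w w′ : Word) : Set (c ⊔ ℓ) where
    field two-sided : ∀ X Y → e22 (X · (π w · Y)) ≈ s * e22 (X · (π w′ · Y))

  record LeftSided (s : Carrier) (w w′ : Word) : Set (c ⊔ ℓ) where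
    field left-sided : ∀ X → e22 (X · π w) ≈ s * e22 (X · π w′)

  record RightSided (s : Carrier) (w w′ : Word) : Set (c ⊔ ℓ) where
    field right-sided : ∀ Y → e22 (π w · Y) ≈ s * e22 (π w′ · Y)

  open TwoSided
  open LeftSided
  open RightSided

  two-sided-∼ : ∀ {s w w′} → ¬ s ≈ 0# → TwoSided s w w′ → ∀ x y → (x ++ w ++ y) ∼ (x ++ w′ ++ y)
  two-sided-∼ {s} {w} {w′} s≉0 w≐w′ x y = ∼-of-e22 (x ++ w ++ y) (x ++ w′ ++ y) s≉0 (begin
    e22 (π (x ++ w ++ y))              ≈⟨ e22≈ (π-++-++ x w y) ⟩
    e22 (π x · (π w · π y))            ≈⟨ two-sided w≐w′ (π x) (π y) ⟩
    s * e22 (π x · (π w′ · π y))       ≈⟨ *-congˡ (e22≈ (π-++-++ x w′ y)) ⟨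
    s * e22 (π (x ++ w′ ++ y))         ∎)

  left-sided-∼ : ∀ {s w w′} → ¬ s ≈ 0# → LeftSided s w w′ → ∀ x → (x ++ w) ∼ (x ++ w′)
  left-sided-∼ {s} {w} {w′} s≉0 w≐w′ x = ∼-of-e22 (x ++ w) (x ++ w′) s≉0 (begin
    e22 (π (x ++ w))          ≈⟨ e22≈ (π-++ x w) ⟩
    e22 (π x · π w)           ≈⟨ left-sided w≐w′ (π x) ⟩
    s * e22 (π x · π w′)      ≈⟨ *-congˡ (e22≈ (π-++ x w′)) ⟨
    s * e22 (π (x ++ w′))     ∎)

  right-sided-∼ : ∀ {s w w′} → ¬ s ≈ 0# → RightSided s w w′ → ∀ y → (w ++ y) ∼ (w′ ++ y)
  right-sided-∼ {s} {w} {w′} s≉0 w≐w′ y = ∼-of-e22 (w ++ y) (w′ ++ y) s≉0 (begin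
    e22 (π (w ++ y))          ≈⟨ e22≈ (π-++ w y) ⟩
    e22 (π w · π y)           ≈⟨ right-sided w≐w′ (π y) ⟩
    s * e22 (π w′ · π y)      ≈⟨ *-congˡ (e22≈ (π-++ w′ y)) ⟨
    s * e22 (π (w′ ++ y))     ∎)

  -- Polynomial copies of _·_, M and π.  Their evaluations are definitionally the
  -- corresponding expressions in Mat, so the solver proves identities about π.
  record Matₚ (n : ℕ) : Set where
    constructor matₚ
    field
      e11ₚ e12ₚ e21ₚ e22ₚ : Polynomial n
  open Matₚ

  infixl 7 _·ₚ_
  _·ₚ_ : ∀ {n} → Matₚ n → Matₚ n → Matₚ n
  matₚ a b c d ·ₚ matₚ a′ b′ c′ d′ =
    matₚ (a :* a′ :+ b :* c′) (a :* b′ :+ b :* d′) (c :* a′ :+ d :* c′) (c :* b′ :+ d :* d′)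

  0ₚ 1ₚ -1ₚ : ∀ {n} → Polynomial n
  0ₚ  = con (+ 0)
  1ₚ  = con (+ 1)
  -1ₚ = :- 1ₚ

  πₚ : ∀ {n} → List (Polynomial n) → Matₚ n
  πₚ []      = matₚ 1ₚ 0ₚ 0ₚ 1ₚ
  πₚ (α ∷ w) = matₚ 0ₚ -1ₚ 1ₚ α ·ₚ πₚ w

  two-sidedₚ : ∀ {n} → Polynomial n → List (Polynomial n) → List (Polynomial n) →
               (x₁ x₂ x₃ x₄ y₁ y₂ y₃ y₄ : Polynomial n) → Polynomial n × Polynomial n
  two-sidedₚ s w w′ x₁ x₂ x₃ x₄ y₁ y₂ y₃ y₄ =
    e22ₚ (X ·ₚ (πₚ w ·ₚ Y)) := s :* e22ₚ (X ·ₚ (πₚ w′ ·ₚ Y))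
    where
    X = matₚ x₁ x₂ x₃ x₄
    Y = matₚ y₁ y₂ y₃ y₄

  left-sidedₚ right-sidedₚ : ∀ {n} → Polynomial n → List (Polynomial n) → List (Polynomial n) →
                             (z₁ z₂ z₃ z₄ : Polynomial n) → Polynomial n × Polynomial n
  left-sidedₚ  s w w′ z₁ z₂ z₃ z₄ = e22ₚ (Z ·ₚ πₚ w) := s :* e22ₚ (Z ·ₚ πₚ w′)
    where Z = matₚ z₁ z₂ z₃ z₄
  right-sidedₚ s w w′ z₁ z₂ z₃ z₄ = e22ₚ (πₚ w ·ₚ Z) := s :* e22ₚ (πₚ w′ ·ₚ Z)
    where Z = matₚ z₁ z₂ z₃ z₄

  π-00 : TwoSided (- 1#) (0# ∷ 0# ∷ []) []
  π-00 .two-sided (mat x₁ x₂ x₃ x₄) (mat y₁ y₂ y₃ y₄) =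
    solve 8 (two-sidedₚ -1ₚ (0ₚ ∷ 0ₚ ∷ []) []) refl x₁ x₂ x₃ x₄ y₁ y₂ y₃ y₄

  π-α1β : ∀ α β → TwoSided 1# (α ∷ 1# ∷ β ∷ []) ((α - 1#) ∷ (β - 1#) ∷ [])
  π-α1β α β .two-sided (mat x₁ x₂ x₃ x₄) (mat y₁ y₂ y₃ y₄) =
    solve 10 (λ α β → two-sidedₚ 1ₚ (α ∷ 1ₚ ∷ β ∷ []) ((α :- 1ₚ) ∷ (β :- 1ₚ) ∷ []))
      refl α β x₁ x₂ x₃ x₄ y₁ y₂ y₃ y₄

  π-α[-1]β : ∀ α β → TwoSided (- 1#) (α ∷ - 1# ∷ β ∷ []) ((α + 1#) ∷ (β + 1#) ∷ [])
  π-α[-1]β α β .two-sided (mat x₁ x₂ x₃ x₄) (mat y₁ y₂ y₃ y₄) =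
    solve 10 (λ α β → two-sidedₚ -1ₚ (α ∷ -1ₚ ∷ β ∷ []) ((α :+ 1ₚ) ∷ (β :+ 1ₚ) ∷ []))
      refl α β x₁ x₂ x₃ x₄ y₁ y₂ y₃ y₄

  π-α1 : ∀ α → LeftSided 1# (α ∷ 1# ∷ []) ((α - 1#) ∷ [])
  π-α1 α .left-sided (mat z₁ z₂ z₃ z₄) =
    solve 5 (λ α → left-sidedₚ 1ₚ (α ∷ 1ₚ ∷ []) ((α :- 1ₚ) ∷ [])) refl α z₁ z₂ z₃ z₄

  π-α[-1] : ∀ α → LeftSided (- 1#) (α ∷ - 1# ∷ []) ((α + 1#) ∷ [])
  π-α[-1] α .left-sided (mat z₁ z₂ z₃ z₄) =
    solve 5 (λ α → left-sidedₚ -1ₚ (α ∷ -1ₚ ∷ []) ((α :+ 1ₚ) ∷ [])) refl α z₁ z₂ z₃ z₄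

  π-1β : ∀ β → RightSided 1# (1# ∷ β ∷ []) ((β - 1#) ∷ [])
  π-1β β .right-sided (mat z₁ z₂ z₃ z₄) =
    solve 5 (λ β → right-sidedₚ 1ₚ (1ₚ ∷ β ∷ []) ((β :- 1ₚ) ∷ [])) refl β z₁ z₂ z₃ z₄

  π-[-1]β : ∀ β → RightSided (- 1#) (- 1# ∷ β ∷ []) ((β + 1#) ∷ [])
  π-[-1]β β .right-sided (mat z₁ z₂ z₃ z₄) =
    solve 5 (λ β → right-sidedₚ -1ₚ (-1ₚ ∷ β ∷ []) ((β :+ 1ₚ) ∷ [])) refl β z₁ z₂ z₃ z₄

  π-0β : ∀ β → RightSided (- 1#) (0# ∷ β ∷ []) []
  π-0β β .right-sided (mat z₁ z₂ z₃ z₄) =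
    solve 5 (λ β → right-sidedₚ -1ₚ (0ₚ ∷ β ∷ []) []) refl β z₁ z₂ z₃ z₄

  π-αβ : ∀ {α ι} β → α * ι ≈ 1# → RightSided α (α ∷ β ∷ []) ((β - ι) ∷ [])
  π-αβ {α} {ι} β αι≈1 .right-sided Y@(mat z₁ z₂ z₃ z₄) = begin
    e22 (π (α ∷ β ∷ []) · Y)                                      ≈⟨ expand α ι β z₁ z₂ z₃ z₄ ⟩
    α * e22 (π ((β - ι) ∷ []) · Y) + (α * ι - 1#) * z₄           ≈⟨ +-congˡ (*-congʳ αι-1≈0) ⟩
    α * e22 (π ((β - ι) ∷ []) · Y) + 0# * z₄                     ≈⟨ +-congˡ (zeroˡ z₄) ⟩
    α * e22 (π ((β - ι) ∷ []) · Y) + 0#                          ≈⟨ +-identityʳ _ ⟩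
    α * e22 (π ((β - ι) ∷ []) · Y)                                ∎
    where
    expand : ∀ α ι β z₁ z₂ z₃ z₄ → e22 (π (α ∷ β ∷ []) · mat z₁ z₂ z₃ z₄)
               ≈ α * e22 (π ((β - ι) ∷ []) · mat z₁ z₂ z₃ z₄) + (α * ι - 1#) * z₄
    expand = solve 7 (λ α ι β z₁ z₂ z₃ z₄ →
      e22ₚ (πₚ (α ∷ β ∷ []) ·ₚ matₚ z₁ z₂ z₃ z₄)
        := α :* e22ₚ (πₚ ((β :- ι) ∷ []) ·ₚ matₚ z₁ z₂ z₃ z₄) :+ (α :* ι :- 1ₚ) :* z₄) refl
    αι-1≈0 : α * ι - 1# ≈ 0#
    αι-1≈0 = trans (+-congʳ αι≈1) (-‿inverseʳ 1#)

  π-1 : e22 (π (1# ∷ [])) ≈ 1# * e22 (π [])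
  π-1 = solve 0 (e22ₚ (πₚ (1ₚ ∷ [])) := 1ₚ :* e22ₚ (πₚ [])) refl

  π-[-1] : e22 (π (- 1# ∷ [])) ≈ - 1# * e22 (π [])
  π-[-1] = solve 0 (e22ₚ (πₚ (-1ₚ ∷ [])) := -1ₚ :* e22ₚ (πₚ [])) refl

  x00y∼xy : ∀ x y → (x ++ 0# ∷ 0# ∷ y) ∼ (x ++ y)
  x00y∼xy = two-sided-∼ -1≉0 π-00

  xα1βy∼x[α-1][β-1]y : ∀ x y α β → (α ≡ nothing → x ≡ []) → (β ≡ nothing → y ≡ []) →
    (x ++ toWord α ++ 1# ∷ toWord β ++ y) ∼ (x ++ toWord (dec α) ++ toWord (dec β) ++ y)
  xα1βy∼x[α-1][β-1]y x y (just α) (just β) _ _ = two-sided-∼ 1≉0 (π-α1β α β) x y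
  xα1βy∼x[α-1][β-1]y x y (just α) nothing  _ ε⇒y≡[] with ≡.refl ← ε⇒y≡[] ≡.refl =
    left-sided-∼ 1≉0 (π-α1 α) x
  xα1βy∼x[α-1][β-1]y x y nothing (just β)  ε⇒x≡[] _ with ≡.refl ← ε⇒x≡[] ≡.refl =
    right-sided-∼ 1≉0 (π-1β β) y
  xα1βy∼x[α-1][β-1]y x y nothing nothing   ε⇒x≡[] ε⇒y≡[]
    with ≡.refl ← ε⇒x≡[] ≡.refl | ≡.refl ← ε⇒y≡[] ≡.refl = ∼-of-e22 (1# ∷ []) [] 1≉0 π-1

  xα[-1]βy∼x[α+1][β+1]y : ∀ x y α β → (α ≡ nothing → x ≡ []) → (β ≡ nothing → y ≡ []) →
    (x ++ toWord α ++ - 1# ∷ toWord β ++ y) ∼ (x ++ toWord (inc α) ++ toWord (inc β) ++ y)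
  xα[-1]βy∼x[α+1][β+1]y x y (just α) (just β) _ _ = two-sided-∼ -1≉0 (π-α[-1]β α β) x y
  xα[-1]βy∼x[α+1][β+1]y x y (just α) nothing  _ ε⇒y≡[] with ≡.refl ← ε⇒y≡[] ≡.refl =
    left-sided-∼ -1≉0 (π-α[-1] α) x
  xα[-1]βy∼x[α+1][β+1]y x y nothing (just β)  ε⇒x≡[] _ with ≡.refl ← ε⇒x≡[] ≡.refl =
    right-sided-∼ -1≉0 (π-[-1]β β) y
  xα[-1]βy∼x[α+1][β+1]y x y nothing nothing   ε⇒x≡[] ε⇒y≡[]
    with ≡.refl ← ε⇒x≡[] ≡.refl | ≡.refl ← ε⇒y≡[] ≡.refl = ∼-of-e22 (- 1# ∷ []) [] -1≉0 π-[-1]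

  αβx∼[β-α⁻¹]x : ∀ α β x → ¬ α ≈ 0# → (α ∷ β ∷ x) ∼ ((β - α ⁻¹) ∷ x)
  αβx∼[β-α⁻¹]x α β x α≉0 = right-sided-∼ α≉0 (π-αβ β (⁻¹-inverseʳ α α≉0)) x

  0βx∼x : ∀ β x → (0# ∷ β ∷ x) ∼ x
  0βx∼x β = right-sided-∼ -1≉0 (π-0β β)

proposition2p4 : {c ℓ : Level} (k : Field c ℓ) →
    let open Field k
        open FieldWords k
    in ((x y : Word) → (x ++ 0# ∷ 0# ∷ y) ∼ (x ++ y))
     × ((x y : Word) (α β : Maybe Carrier) →
          (α ≡ nothing → x ≡ []) → (β ≡ nothing → y ≡ []) →
          ((x ++ toWord α ++ 1# ∷ toWord β ++ y) ∼ (x ++ toWord (dec α) ++ toWord (dec β) ++ y))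
          × ((x ++ toWord α ++ (- 1#) ∷ toWord β ++ y) ∼ (x ++ toWord (inc α) ++ toWord (inc β) ++ y)))
     × ((α β : Carrier) (x : Word) → ¬ (α ≈ 0#) →
          (α ∷ β ∷ x) ∼ ((β - α ⁻¹) ∷ x))
     × ((β : Carrier) (x : Word) → (0# ∷ β ∷ x) ∼ x)
proposition2p4 k =
    x00y∼xy
  , (λ x y α β hα hβ → xα1βy∼x[α-1][β-1]y x y α β hα hβ , xα[-1]βy∼x[α+1][β+1]y x y α β hα hβ)
  , αβx∼[β-α⁻¹]x
  , 0βx∼x
  where open WordClasses k
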